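{- Suppose that $\mathrm{mac}(G)\ge\frac45 w(G)$ holds for every connected edge-weighted triangle-free graph $G$ with $\Delta(G)\le 3$ (weights non-negative reals). Then every connected triangle-free graph $G$ with $\Delta(G)\le 3$ contains a set $E'$ of edges such that every 5-cycle of $G$ contains exactly one edge of $E'$.
   Context: $w(G)$ is the sum of all edge weights. $\mathrm{mac}(G)$ is the maximum total weight of the edges between $A$ and $B$ over all partitions $(A,B)$ of $V(G)$. Triangle-free means containing no $K_3$ subgraph; $\Delta(G)$ is the maximum degree. -}

module Defs where

open import Data.Nat as ℕ using (ℕ; suc)
open import Data.Bool using (Bool; true; false; _∧_; not; if_then_else_)
open import Data.Fin using (Fin; zero; suc; toℕ)
open import Data.Fin.Properties using (_≟_)
open import Data.List using (List; []; _∷_; filterᵇ; allFin; length; map; foldr; cartesianProduct)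
open import Data.Product using (_×_; _,_; proj₁; proj₂; Σ; ∃; ∃-syntax)
open import Data.Rational using (ℚ; 0ℚ; _+_; _*_; _≤_; _/_)
open import Data.Integer using (+_)
open import Function using (_∘_)
open import Relation.Binary.PropositionalEquality using (_≡_; _≢_)
open import Relation.Nullary using (¬_)
open import Relation.Nullary.Decidable using (⌊_⌋)
open import Data.Empty using (⊥)

record Graph (n : ℕ) : Set where
  field
    adj     : Fin n → Fin n → Bool
    adj-sym : ∀ i j → adj i j ≡ adj j i
    irrefl  : ∀ i → adj i i ≡ false
open Graph public

neighbours : ∀ {n} → Graph n → Fin n → List (Fin n)
neighbours G v = filterᵇ (adj G v) (allFin _)

degree : ∀ {n} → Graph n → Fin n → ℕ
degree G v = length (neighbours G v)

MaxDegreeAtMost : ∀ {n} → Graph n → ℕ → Set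
MaxDegreeAtMost G k = ∀ v → degree G v ℕ.≤ k

TriangleFree : ∀ {n} → Graph n → Set
TriangleFree G = ∀ i j k → adj G i j ≡ true → adj G j k ≡ true → adj G i k ≡ false

data Reachable {n} (G : Graph n) : Fin n → Fin n → Set where
  here : ∀ {v} → Reachable G v v
  step : ∀ {u v w} → adj G u v ≡ true → Reachable G v w → Reachable G u w

Connected : ∀ {n} → Graph n → Set
Connected G = ∀ u v → Reachable G u v

edges : ∀ {n} → Graph n → List (Fin n × Fin n)
edges {n} G = filterᵇ (λ p → (toℕ (proj₁ p) ℕ.<ᵇ toℕ (proj₂ p)) ∧ adj G (proj₁ p) (proj₂ p))
                      (cartesianProduct (allFin n) (allFin n))

sumℚ : List ℚ → ℚ
sumℚ = foldr _+_ 0ℚ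

-- Edge weights: a weight for each (unordered) vertex pair; only the values
-- w i j with i < j and {i,j} an edge are ever used.
Weights : ℕ → Set
Weights n = Fin n → Fin n → ℚ

NonNegative : ∀ {n} → Weights n → Set
NonNegative w = ∀ i j → 0ℚ ≤ w i j

totalWeight : ∀ {n} → Graph n → Weights n → ℚ
totalWeight G w = sumℚ (map (λ p → w (proj₁ p) (proj₂ p)) (edges G))

-- A partition (A , B) of V(G) is given by its indicator A : Fin n → Bool
-- (B is the complement).  cutWeight = total weight of edges between A and B.
cutWeight : ∀ {n} → Graph n → Weights n → (Fin n → Bool) → ℚ
cutWeight G w A =
  sumℚ (map (λ p → w (proj₁ p) (proj₂ p))
            (filterᵇ (λ p → not ⌊ A (proj₁ p) Data.Bool.≟ A (proj₂ p) ⌋) (edges G)))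
  where import Data.Bool

-- mac(G) ≥ x  (mac is the maximum of cutWeight over the finitely many
-- partitions, so this says some partition achieves at least x).
MacAtLeast : ∀ {n} → Graph n → Weights n → ℚ → Set
MacAtLeast G w x = ∃[ A ] x ≤ cutWeight G w A

fourFifths : ℚ
fourFifths = + 4 / 5

next5 : Fin 5 → Fin 5
next5 zero = suc zero
next5 (suc zero) = suc (suc zero)
next5 (suc (suc zero)) = suc (suc (suc zero))
next5 (suc (suc (suc zero))) = suc (suc (suc (suc zero)))
next5 (suc (suc (suc (suc zero)))) = zero

record FiveCycle {n} (G : Graph n) : Set where
  field
    vtx      : Fin 5 → Fin n
    distinct : ∀ k l → vtx k ≡ vtx l → k ≡ l
    adjacent : ∀ k → adj G (vtx k) (vtx (next5 k)) ≡ true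
open FiveCycle public

record EdgeSet {n} (G : Graph n) : Set where
  field
    mem     : Fin n → Fin n → Bool
    mem-sym : ∀ i j → mem i j ≡ mem j i
    mem-adj : ∀ i j → mem i j ≡ true → adj G i j ≡ true
open EdgeSet public

edgesOfCycleIn : ∀ {n} {G : Graph n} → EdgeSet G → FiveCycle G → ℕ
edgesOfCycleIn E C = length (filterᵇ (λ k → mem E (vtx C k) (vtx C (next5 k))) (allFin 5))

-- Give every edge the weight "number of closed 5-walks through it", counted
-- with multiplicity. The total weight is then 5 times the number of closed
-- 5-walks, whereas a partition (A, B) can cut at most 4 of the 5 steps of a
-- closed 5-walk, since 5 is odd. So a cut of weight at least 4/5 of the total
-- cuts exactly 4 steps of every closed 5-walk, and the edges inside A or inside
-- B form a set meeting every 5-cycle exactly once.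
module Submission where

open import Defs
open import Data.Nat using (ℕ)
open import Data.Rational using (_*_; _≤_)
open import Relation.Binary.PropositionalEquality using (_≡_)
open import Data.Product using (Σ; ∃; ∃-syntax)

open import Data.Bool as Bool using (Bool; true; false; _∧_; not; T)
open import Data.Bool.ListAction using (all)
open import Data.Bool.Properties using (T-≡; T-∧)
open import Data.Empty using (⊥-elim)
open import Data.Fin using (Fin; toℕ; #_)
open import Data.Fin.Properties using (toℕ-injective) renaming (_≟_ to _≟ᶠ_)
open import Data.Integer as ℤ using (+≤+)
import Data.Integer.Properties as ℤP
open import Data.List using (List; []; _∷_; filterᵇ; allFin; length; map; cartesianProduct)
open import Data.List.Membership.Propositional using (_∈_; _∉_)
open import Data.List.Membership.Propositional.Properties
  using (∈-filter⁺; ∈-filter⁻; ∈-cartesianProduct⁺; ∈-allFin)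
open import Data.List.Relation.Unary.All as All using (All; []; _∷_)
open import Data.List.Relation.Unary.All.Properties using (all⁺; all⁻)
open import Data.List.Relation.Unary.Any using (here; there)
open import Data.List.Relation.Unary.Unique.Propositional using (Unique; []; _∷_)
open import Data.List.Relation.Unary.Unique.Propositional.Properties
  using (Unique[x∷xs]⇒x∉xs; filter⁺; cartesianProduct⁺; allFin⁺)
import Data.Nat as ℕ
open import Data.Nat using (suc; _+_; z≤n; s≤s) renaming (_*_ to _·_; _≤_ to _≤ℕ_)
import Data.Nat.Coprimality as Coprimality
open import Data.Nat.Properties as ℕP
  using (≤-trans; ≤-antisym; +-cancelˡ-≤; +-cancelʳ-≤; +-monoˡ-≤; +-monoʳ-≤; +-mono-≤; *-cancelˡ-≤)
open import Algebra.Properties.CommutativeSemigroup ℕP.+-commutativeSemigroup using (interchange; x∙yz≈y∙xz)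
open import Data.Nat.Solver using (module +-*-Solver)
open +-*-Solver using (solve; _:=_; _:+_; _:*_; con)
open import Data.Product using (_×_; _,_; proj₁; proj₂)
open import Data.Product.Properties using (≡-dec)
open import Data.Rational as ℚ using (ℚ; mkℚ; 0ℚ)
open import Data.Rational.Properties
  using (toℚᵘ-mono-≤; toℚᵘ-cancel-≤; toℚᵘ-homo-*; toℚᵘ-homo-+; toℚᵘ-injective)
open import Data.Rational.Unnormalised using (*≤*; *≡*)
import Data.Rational.Unnormalised.Properties as ℚᵘ
open import Function using (_∘_; Equivalence)
open import Relation.Binary.Definitions using (DecidableEquality; Tri; tri<; tri≈; tri>)
open import Relation.Binary.PropositionalEquality
  using (refl; sym; trans; cong; cong₂; subst; subst₂; module ≡-Reasoning)
open import Relation.Nullary using (yes; no)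
open import Relation.Nullary.Decidable using (⌊_⌋; T?)

open Equivalence using (to; from)

𝟙 : Bool → ℕ
𝟙 true  = 1
𝟙 false = 0

∑ : {A : Set} → List A → (A → ℕ) → ℕ
∑ []       f = 0
∑ (x ∷ xs) f = f x + ∑ xs f

infix 5 ∑
syntax ∑ xs (λ x → f) = ∑[ x ∈ xs ] f

private
  variable
    X Y : Set

∑-cong : ∀ xs {f g : X → ℕ} → (∀ {x} → x ∈ xs → f x ≡ g x) → ∑ xs f ≡ ∑ xs g
∑-cong []       f≡g = refl
∑-cong (x ∷ xs) f≡g = cong₂ _+_ (f≡g (here refl)) (∑-cong xs (f≡g ∘ there))

∑-zero : ∀ (xs : List X) → ∑[ x ∈ xs ] 0 ≡ 0
∑-zero []       = refl
∑-zero (x ∷ xs) = ∑-zero xs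

∑-+ : ∀ xs (f g : X → ℕ) → ∑[ x ∈ xs ] (f x + g x) ≡ ∑ xs f + ∑ xs g
∑-+ []       f g = refl
∑-+ (x ∷ xs) f g = begin
  f x + g x + (∑[ y ∈ xs ] f y + g y) ≡⟨ cong ((f x + g x) +_) (∑-+ xs f g) ⟩
  f x + g x + (∑ xs f + ∑ xs g)       ≡⟨ interchange (f x) (g x) (∑ xs f) (∑ xs g) ⟩
  f x + ∑ xs f + (g x + ∑ xs g)       ∎
  where open ≡-Reasoning

∑-*ˡ : ∀ xs c (f : X → ℕ) → ∑[ x ∈ xs ] (c · f x) ≡ c · ∑ xs f
∑-*ˡ []       c f = sym (ℕP.*-zeroʳ c)
∑-*ˡ (x ∷ xs) c f = trans (cong (c · f x +_) (∑-*ˡ xs c f)) (sym (ℕP.*-distribˡ-+ c (f x) (∑ xs f)))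

∑-mono-≤ : ∀ xs {f g : X → ℕ} → (∀ x → f x ≤ℕ g x) → ∑ xs f ≤ℕ ∑ xs g
∑-mono-≤ []       f≤g = z≤n
∑-mono-≤ (x ∷ xs) f≤g = +-mono-≤ (f≤g x) (∑-mono-≤ xs f≤g)

∑-≤-pointwise⇒≡ : ∀ xs {f g : X → ℕ} → (∀ x → g x ≤ℕ f x) → ∑ xs f ≤ℕ ∑ xs g →
                  ∀ {x} → x ∈ xs → f x ≡ g x
∑-≤-pointwise⇒≡ (y ∷ ys) {f} {g} g≤f ∑f≤∑g (here refl) = ≤-antisym fy≤gy (g≤f y)
  where
  fy≤gy : f y ≤ℕ g y
  fy≤gy = +-cancelʳ-≤ (∑ ys f) (f y) (g y)
            (≤-trans ∑f≤∑g (+-monoʳ-≤ (g y) (∑-mono-≤ ys g≤f)))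
∑-≤-pointwise⇒≡ (y ∷ ys) {f} {g} g≤f ∑f≤∑g (there x∈ys) = ∑-≤-pointwise⇒≡ ys g≤f ∑ys≤ x∈ys
  where
  ∑ys≤ : ∑ ys f ≤ℕ ∑ ys g
  ∑ys≤ = +-cancelˡ-≤ (f y) (∑ ys f) (∑ ys g) (≤-trans ∑f≤∑g (+-monoˡ-≤ (∑ ys g) (g≤f y)))

∑-filterᵇ : ∀ (P : X → Bool) xs f → ∑ (filterᵇ P xs) f ≡ ∑[ x ∈ xs ] f x · 𝟙 (P x)
∑-filterᵇ P []       f = refl
∑-filterᵇ P (x ∷ xs) f with P x
... | true  = cong₂ _+_ (sym (ℕP.*-identityʳ (f x))) (∑-filterᵇ P xs f)
... | false = trans (∑-filterᵇ P xs f) (cong (_+ (∑[ y ∈ xs ] f y · 𝟙 (P y))) (sym (ℕP.*-zeroʳ (f x))))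

∑-filterᵇ-partition : ∀ (P : X → Bool) xs f → ∑ (filterᵇ (not ∘ P) xs) f + ∑ (filterᵇ P xs) f ≡ ∑ xs f
∑-filterᵇ-partition P []       f = refl
∑-filterᵇ-partition P (x ∷ xs) f with P x
... | true  = trans (x∙yz≈y∙xz (∑ (filterᵇ (not ∘ P) xs) f) (f x) (∑ (filterᵇ P xs) f))
                    (cong (f x +_) (∑-filterᵇ-partition P xs f))
... | false = trans (ℕP.+-assoc (f x) (∑ (filterᵇ (not ∘ P) xs) f) (∑ (filterᵇ P xs) f))
                    (cong (f x +_) (∑-filterᵇ-partition P xs f))

length-filterᵇ : ∀ (P : X → Bool) xs → length (filterᵇ P xs) ≡ ∑[ x ∈ xs ] 𝟙 (P x)
length-filterᵇ P []       = refl
length-filterᵇ P (x ∷ xs) with P x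
... | true  = cong suc (length-filterᵇ P xs)
... | false = length-filterᵇ P xs

∑-∑-*ʳ-comm : ∀ (ys : List Y) xs (f : X → Y → ℕ) (g : Y → ℕ) →
              (∑[ y ∈ ys ] (∑[ x ∈ xs ] f x y) · g y) ≡ (∑[ x ∈ xs ] ∑[ y ∈ ys ] f x y · g y)
∑-∑-*ʳ-comm ys []       f g = ∑-zero ys
∑-∑-*ʳ-comm ys (x ∷ xs) f g = begin
  (∑[ y ∈ ys ] (f x y + (∑[ x′ ∈ xs ] f x′ y)) · g y)
    ≡⟨ ∑-cong ys (λ {y} _ → ℕP.*-distribʳ-+ (g y) (f x y) (∑[ x′ ∈ xs ] f x′ y)) ⟩
  (∑[ y ∈ ys ] f x y · g y + (∑[ x′ ∈ xs ] f x′ y) · g y)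
    ≡⟨ ∑-+ ys (λ y → f x y · g y) (λ y → (∑[ x′ ∈ xs ] f x′ y) · g y) ⟩
  (∑[ y ∈ ys ] f x y · g y) + (∑[ y ∈ ys ] (∑[ x′ ∈ xs ] f x′ y) · g y)
    ≡⟨ cong ((∑[ y ∈ ys ] f x y · g y) +_) (∑-∑-*ʳ-comm ys xs f g) ⟩
  (∑[ y ∈ ys ] f x y · g y) + (∑[ x′ ∈ xs ] ∑[ y ∈ ys ] f x′ y · g y) ∎
  where open ≡-Reasoning

module _ {X : Set} (_≟_ : DecidableEquality X) where

  ∑-indicator-∉ : ∀ {q} xs (h : X → ℕ) → q ∉ xs → ∑[ x ∈ xs ] 𝟙 ⌊ x ≟ q ⌋ · h x ≡ 0
  ∑-indicator-∉         []       h q∉ = refl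
  ∑-indicator-∉ {q} (x ∷ xs) h q∉ with x ≟ q
  ... | yes refl = ⊥-elim (q∉ (here refl))
  ... | no  _    = ∑-indicator-∉ xs h (q∉ ∘ there)

  ∑-indicator-∈ : ∀ {q} xs (h : X → ℕ) → Unique xs → q ∈ xs →
                  ∑[ x ∈ xs ] 𝟙 ⌊ x ≟ q ⌋ · h x ≡ h q
  ∑-indicator-∈ (x ∷ xs) h x∷xs-unique (here refl) with x ≟ x
  ... | yes _  = trans (cong₂ _+_ (ℕP.+-identityʳ (h x)) (∑-indicator-∉ xs h (Unique[x∷xs]⇒x∉xs x∷xs-unique)))
                       (ℕP.+-identityʳ (h x))
  ... | no x≢x = ⊥-elim (x≢x refl)
  ∑-indicator-∈ {q} (x ∷ xs) h x∷xs-unique@(_ ∷ xs-unique) (there q∈xs) with x ≟ q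
  ... | yes refl = ⊥-elim (Unique[x∷xs]⇒x∉xs x∷xs-unique q∈xs)
  ... | no  _    = ∑-indicator-∈ xs h xs-unique q∈xs

  ⌊≟⌋-sym : ∀ x y → ⌊ x ≟ y ⌋ ≡ ⌊ y ≟ x ⌋
  ⌊≟⌋-sym x y with x ≟ y | y ≟ x
  ... | yes _   | yes _   = refl
  ... | no  _   | no  _   = refl
  ... | yes x≡y | no  y≢x = ⊥-elim (y≢x (sym x≡y))
  ... | no  x≢y | yes y≡x = ⊥-elim (x≢y (sym y≡x))

fromℕ : ℕ → ℚ
fromℕ m = mkℚ (ℤ.+ m) 0 (Coprimality.sym (Coprimality.1-coprimeTo m))

fromℕ-nonNeg : ∀ m → 0ℚ ≤ fromℕ m
fromℕ-nonNeg m = toℚᵘ-cancel-≤ (*≤* (subst (ℤ._≤_ (ℤ.+ 0)) (sym (ℤP.*-identityʳ (ℤ.+ m))) (+≤+ z≤n)))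

fromℕ-+ : ∀ a b → fromℕ a ℚ.+ fromℕ b ≡ fromℕ (a + b)
fromℕ-+ a b = toℚᵘ-injective
  (ℚᵘ.≃-trans (toℚᵘ-homo-+ (fromℕ a) (fromℕ b)) (*≡* (cong (ℤ._* ℤ.+ 1) numerators)))
  where
  numerators : ℤ.+ a ℤ.* ℤ.+ 1 ℤ.+ ℤ.+ b ℤ.* ℤ.+ 1 ≡ ℤ.+ (a + b)
  numerators = trans (cong₂ ℤ._+_ (ℤP.*-identityʳ (ℤ.+ a)) (ℤP.*-identityʳ (ℤ.+ b))) (sym (ℤP.pos-+ a b))

fourFifths*fromℕ≤fromℕ⇒ : ∀ m k → fourFifths * fromℕ m ≤ fromℕ k → 4 · m ≤ℕ k · 5
fourFifths*fromℕ≤fromℕ⇒ m k le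
  with ℚᵘ.≤-respˡ-≃ (toℚᵘ-homo-* fourFifths (fromℕ m)) (toℚᵘ-mono-≤ le)
... | *≤* le′ = ℤP.drop‿+≤+ (subst₂ ℤ._≤_ lhs (sym (ℤP.pos-* k 5)) le′)
  where
  lhs : (ℤ.+ 4 ℤ.* ℤ.+ m) ℤ.* ℤ.+ 1 ≡ ℤ.+ (4 · m)
  lhs = trans (ℤP.*-identityʳ _) (sym (ℤP.pos-* 4 m))

sumℚ-map-fromℕ : ∀ xs (f : X → ℕ) → sumℚ (map (fromℕ ∘ f) xs) ≡ fromℕ (∑ xs f)
sumℚ-map-fromℕ []       f = refl
sumℚ-map-fromℕ (x ∷ xs) f = trans (cong (fromℕ (f x) ℚ.+_) (sumℚ-map-fromℕ xs f)) (fromℕ-+ (f x) (∑ xs f))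

4[c+u]≤c5⇒u≤m : ∀ {c u m} → c + u ≡ 5 · m → 4 · (c + u) ≤ℕ c · 5 → u ≤ℕ m
4[c+u]≤c5⇒u≤m {c} {u} {m} c+u≡5m 4[c+u]≤c5 = *-cancelˡ-≤ 5 (begin
  5 · u     ≡⟨ solve 1 (λ u → con 5 :* u := u :* con 4 :+ u) refl u ⟩
  u · 4 + u ≤⟨ +-monoˡ-≤ u u4≤c ⟩
  c + u     ≡⟨ c+u≡5m ⟩
  5 · m     ∎)
  where
  open ℕP.≤-Reasoning
  u4≤c : u · 4 ≤ℕ c
  u4≤c = +-cancelˡ-≤ (c · 4) (u · 4) c (subst₂ _≤ℕ_
    (solve 2 (λ c u → con 4 :* (c :+ u) := c :* con 4 :+ u :* con 4) refl c u)
    (solve 1 (λ c → c :* con 5 := c :* con 4 :+ c) refl c) 4[c+u]≤c5)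

Walk₅ : Set → Set
Walk₅ V = V × V × V × V × V

steps₅ : {V : Set} → Walk₅ V → List (V × V)
steps₅ (a , b , c , d , e) = (a , b) ∷ (b , c) ∷ (c , d) ∷ (d , e) ∷ (e , a) ∷ []

sameSide : {V : Set} → (V → Bool) → V × V → Bool
sameSide A s = ⌊ A (proj₁ s) Bool.≟ A (proj₂ s) ⌋

monochromatic : {V : Set} → (V → Bool) → List (V × V) → ℕ
monochromatic A ps = ∑[ s ∈ ps ] 𝟙 (sameSide A s)

1≤monochromatic-steps₅ : {V : Set} (A : V → Bool) (W : Walk₅ V) → 1 ≤ℕ monochromatic A (steps₅ W)
1≤monochromatic-steps₅ A (a , b , c , d , e) = on-Bool (A a , A b , A c , A d , A e)
  where
  -- Five is odd, so the values cannot alternate all the way round.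
  on-Bool : (bs : Walk₅ Bool) → 1 ≤ℕ monochromatic (λ b → b) (steps₅ bs)
  on-Bool (true  , true  , _     , _     , _    ) = s≤s z≤n
  on-Bool (false , false , _     , _     , _    ) = s≤s z≤n
  on-Bool (true  , false , false , _     , _    ) = s≤s z≤n
  on-Bool (false , true  , true  , _     , _    ) = s≤s z≤n
  on-Bool (true  , false , true  , true  , _    ) = s≤s z≤n
  on-Bool (false , true  , false , false , _    ) = s≤s z≤n
  on-Bool (true  , false , true  , false , false) = s≤s z≤n
  on-Bool (false , true  , false , true  , true ) = s≤s z≤n
  on-Bool (true  , false , true  , false , true ) = s≤s z≤n
  on-Bool (false , true  , false , true  , false) = s≤s z≤n

module _ {n : ℕ} where

  _≟²_ : DecidableEquality (Fin n × Fin n)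
  _≟²_ = ≡-dec _≟ᶠ_ _≟ᶠ_

  crossings : Fin n × Fin n → Fin n × Fin n → ℕ
  crossings e (a , b) = 𝟙 ⌊ e ≟² (a , b) ⌋ + 𝟙 ⌊ e ≟² (b , a) ⌋

  traffic : List (Fin n × Fin n) → Fin n × Fin n → ℕ
  traffic ps e = ∑[ s ∈ ps ] crossings e s

  load₅ : List (Walk₅ (Fin n)) → Fin n × Fin n → ℕ
  load₅ Ws e = ∑[ W ∈ Ws ] traffic (steps₅ W) e

  walks₅ : List (Walk₅ (Fin n))
  walks₅ = cartesianProduct vs (cartesianProduct vs (cartesianProduct vs (cartesianProduct vs vs)))
    where vs = allFin n

module _ {n : ℕ} (G : Graph n) where

  isStep : Fin n × Fin n → Bool
  isStep s = adj G (proj₁ s) (proj₂ s)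

  isEdge : Fin n × Fin n → Bool
  isEdge s = (toℕ (proj₁ s) ℕ.<ᵇ toℕ (proj₂ s)) ∧ isStep s

  ∈-edges : ∀ {a b} → toℕ a ℕ.< toℕ b → T (adj G a b) → (a , b) ∈ edges G
  ∈-edges a<b ab = ∈-filter⁺ (T? ∘ isEdge) (∈-cartesianProduct⁺ (∈-allFin _) (∈-allFin _))
                             (from T-∧ (ℕP.<⇒<ᵇ a<b , ab))

  edges-ordered : ∀ {a b} → (a , b) ∈ edges G → toℕ a ℕ.< toℕ b
  edges-ordered ab∈ = ℕP.<ᵇ⇒< _ _ (proj₁ (to T-∧ (proj₂
    (∈-filter⁻ (T? ∘ isEdge) {xs = cartesianProduct (allFin n) (allFin n)} ab∈))))

  edges-unique : Unique (edges G)
  edges-unique = filter⁺ (T? ∘ isEdge) (cartesianProduct⁺ (allFin⁺ n) (allFin⁺ n))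

  -- Exactly one orientation of each edge of G occurs in edges G.
  ∑-edges-crossings : (g : Fin n × Fin n → ℕ) → (∀ a b → g (a , b) ≡ g (b , a)) →
                      ∀ {a b} → T (adj G a b) → (∑[ e ∈ edges G ] crossings e (a , b) · g e) ≡ g (a , b)
  ∑-edges-crossings g g-sym {a} {b} ab = begin
    (∑[ e ∈ edges G ] crossings e (a , b) · g e)
      ≡⟨ ∑-cong (edges G) (λ {e} _ →
           ℕP.*-distribʳ-+ (g e) (𝟙 ⌊ e ≟² (a , b) ⌋) (𝟙 ⌊ e ≟² (b , a) ⌋)) ⟩
    (∑[ e ∈ edges G ] 𝟙 ⌊ e ≟² (a , b) ⌋ · g e + 𝟙 ⌊ e ≟² (b , a) ⌋ · g e)
      ≡⟨ ∑-+ (edges G) (λ e → 𝟙 ⌊ e ≟² (a , b) ⌋ · g e) (λ e → 𝟙 ⌊ e ≟² (b , a) ⌋ · g e) ⟩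
    (∑[ e ∈ edges G ] 𝟙 ⌊ e ≟² (a , b) ⌋ · g e) + (∑[ e ∈ edges G ] 𝟙 ⌊ e ≟² (b , a) ⌋ · g e)
      ≡⟨ one-orientation (ℕP.<-cmp (toℕ a) (toℕ b)) ⟩
    g (a , b) ∎
    where
    open ≡-Reasoning
    ∑-point : ∀ {q} → q ∈ edges G → (∑[ e ∈ edges G ] 𝟙 ⌊ e ≟² q ⌋ · g e) ≡ g q
    ∑-point = ∑-indicator-∈ _≟²_ (edges G) g edges-unique
    ∑-point-∉ : ∀ {q} → q ∉ edges G → (∑[ e ∈ edges G ] 𝟙 ⌊ e ≟² q ⌋ · g e) ≡ 0
    ∑-point-∉ = ∑-indicator-∉ _≟²_ (edges G) g
    one-orientation : Tri (toℕ a ℕ.< toℕ b) (toℕ a ≡ toℕ b) (toℕ b ℕ.< toℕ a) →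
      (∑[ e ∈ edges G ] 𝟙 ⌊ e ≟² (a , b) ⌋ · g e) + (∑[ e ∈ edges G ] 𝟙 ⌊ e ≟² (b , a) ⌋ · g e)
        ≡ g (a , b)
    one-orientation (tri< a<b _ _) =
      trans (cong₂ _+_ (∑-point (∈-edges a<b ab)) (∑-point-∉ (ℕP.<-asym a<b ∘ edges-ordered)))
            (ℕP.+-identityʳ _)
    one-orientation (tri≈ _ a≡b _) =
      ⊥-elim (subst T (irrefl G a) (subst (T ∘ adj G a) (sym (toℕ-injective a≡b)) ab))
    one-orientation (tri> _ _ b<a) =
      trans (cong₂ _+_ (∑-point-∉ (ℕP.<-asym b<a ∘ edges-ordered))
                       (∑-point (∈-edges b<a (subst T (adj-sym G a b) ab))))
            (sym (g-sym a b))

  ∑-edges-traffic : (g : Fin n × Fin n → ℕ) → (∀ a b → g (a , b) ≡ g (b , a)) →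
                    ∀ {ps} → All (T ∘ isStep) ps → (∑[ e ∈ edges G ] traffic ps e · g e) ≡ (∑[ s ∈ ps ] g s)
  ∑-edges-traffic g g-sym {ps} steps =
    trans (∑-∑-*ʳ-comm (edges G) ps (λ s e → crossings e s) g)
          (∑-cong ps (λ s∈ps → ∑-edges-crossings g g-sym (All.lookup steps s∈ps)))

  ∑-edges-load₅ : (g : Fin n × Fin n → ℕ) → (∀ a b → g (a , b) ≡ g (b , a)) →
                  ∀ {Ws} → (∀ {W} → W ∈ Ws → All (T ∘ isStep) (steps₅ W)) →
                  (∑[ e ∈ edges G ] load₅ Ws e · g e) ≡ (∑[ W ∈ Ws ] ∑[ s ∈ steps₅ W ] g s)
  ∑-edges-load₅ g g-sym {Ws} walks =
    trans (∑-∑-*ʳ-comm (edges G) Ws (λ W e → traffic (steps₅ W) e) g)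
          (∑-cong Ws (λ W∈Ws → ∑-edges-traffic g g-sym (walks W∈Ws)))

  closedWalks₅ : List (Walk₅ (Fin n))
  closedWalks₅ = filterᵇ (all isStep ∘ steps₅) walks₅

  closedWalks₅-steps : ∀ {W} → W ∈ closedWalks₅ → All (T ∘ isStep) (steps₅ W)
  closedWalks₅-steps {W} W∈ =
    all⁺ isStep (steps₅ W) (proj₂ (∈-filter⁻ (T? ∘ (all isStep ∘ steps₅)) {xs = walks₅} W∈))

  loadWeights : Weights n
  loadWeights i j = fromℕ (load₅ closedWalks₅ (i , j))

  ∑-edges-load₅-total : (∑[ e ∈ edges G ] load₅ closedWalks₅ e) ≡ 5 · (∑[ W ∈ closedWalks₅ ] 1)
  ∑-edges-load₅-total = begin
    (∑[ e ∈ edges G ] load₅ closedWalks₅ e)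
      ≡⟨ ∑-cong (edges G) (λ {e} _ → sym (ℕP.*-identityʳ (load₅ closedWalks₅ e))) ⟩
    (∑[ e ∈ edges G ] load₅ closedWalks₅ e · 1)
      ≡⟨ ∑-edges-load₅ (λ _ → 1) (λ _ _ → refl) closedWalks₅-steps ⟩
    (∑[ W ∈ closedWalks₅ ] 5 · 1)
      ≡⟨ ∑-*ˡ closedWalks₅ 5 (λ _ → 1) ⟩
    5 · (∑[ W ∈ closedWalks₅ ] 1) ∎
    where open ≡-Reasoning

  ∑-edges-load₅-sameSide : ∀ A → ∑ (filterᵇ (sameSide A) (edges G)) (load₅ closedWalks₅) ≡
                                 (∑[ W ∈ closedWalks₅ ] monochromatic A (steps₅ W))
  ∑-edges-load₅-sameSide A =
    trans (∑-filterᵇ (sameSide A) (edges G) (load₅ closedWalks₅))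
          (∑-edges-load₅ (𝟙 ∘ sameSide A) (λ a b → cong 𝟙 (⌊≟⌋-sym Bool._≟_ (A a) (A b)))
                         closedWalks₅-steps)

  -- The total weight is 5 per closed 5-walk, so a cut of 4/5 of it leaves on average
  -- at most one uncut step per walk.
  fourFifths-cut⇒monochromatic≤ : ∀ A → fourFifths * totalWeight G loadWeights ≤ cutWeight G loadWeights A →
    (∑[ W ∈ closedWalks₅ ] monochromatic A (steps₅ W)) ≤ℕ (∑[ W ∈ closedWalks₅ ] 1)
  fourFifths-cut⇒monochromatic≤ A ⅘w≤cut =
    subst (_≤ℕ (∑[ W ∈ closedWalks₅ ] 1)) (∑-edges-load₅-sameSide A) (4[c+u]≤c5⇒u≤m total 4w≤5cut)
    where
    cut uncut : ℕ
    cut   = ∑ (filterᵇ (not ∘ sameSide A) (edges G)) (load₅ closedWalks₅)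
    uncut = ∑ (filterᵇ (sameSide A) (edges G)) (load₅ closedWalks₅)
    partition : cut + uncut ≡ (∑[ e ∈ edges G ] load₅ closedWalks₅ e)
    partition = ∑-filterᵇ-partition (sameSide A) (edges G) (load₅ closedWalks₅)
    total : cut + uncut ≡ 5 · (∑[ W ∈ closedWalks₅ ] 1)
    total = trans partition ∑-edges-load₅-total
    4w≤5cut : 4 · (cut + uncut) ≤ℕ cut · 5
    4w≤5cut = subst (λ w → 4 · w ≤ℕ cut · 5) (sym partition)
      (fourFifths*fromℕ≤fromℕ⇒ (∑[ e ∈ edges G ] load₅ closedWalks₅ e) cut
        (subst₂ (λ w c → fourFifths * w ≤ c)
          (sumℚ-map-fromℕ (edges G) (load₅ closedWalks₅))
          (sumℚ-map-fromℕ (filterᵇ (not ∘ sameSide A) (edges G)) (load₅ closedWalks₅))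
          ⅘w≤cut))

  sameSideEdges : (Fin n → Bool) → EdgeSet G
  sameSideEdges A = record
    { mem     = λ i j → adj G i j ∧ sameSide A (i , j)
    ; mem-sym = λ i j → cong₂ _∧_ (adj-sym G i j) (⌊≟⌋-sym Bool._≟_ (A i) (A j))
    ; mem-adj = λ i j → adjacent-if-member {adj G i j}
    }
    where
    adjacent-if-member : ∀ {a b} → a ∧ b ≡ true → a ≡ true
    adjacent-if-member {true} _ = refl

  walk₅ : FiveCycle G → Walk₅ (Fin n)
  walk₅ C = vtx C (# 0) , vtx C (# 1) , vtx C (# 2) , vtx C (# 3) , vtx C (# 4)

  walk₅-closed : ∀ C → walk₅ C ∈ closedWalks₅
  walk₅-closed C = ∈-filter⁺ (T? ∘ (all isStep ∘ steps₅))
    (∈-cartesianProduct⁺ (∈-allFin _) (∈-cartesianProduct⁺ (∈-allFin _)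
      (∈-cartesianProduct⁺ (∈-allFin _) (∈-cartesianProduct⁺ (∈-allFin _) (∈-allFin _)))))
    (all⁻ isStep (edge-of-C (# 0) ∷ edge-of-C (# 1) ∷ edge-of-C (# 2) ∷ edge-of-C (# 3) ∷ edge-of-C (# 4) ∷ []))
    where
    edge-of-C : ∀ k → T (adj G (vtx C k) (vtx C (next5 k)))
    edge-of-C k = from T-≡ (adjacent C k)

  edgesOfCycleIn-sameSideEdges : ∀ A C → edgesOfCycleIn (sameSideEdges A) C ≡ monochromatic A (steps₅ (walk₅ C))
  edgesOfCycleIn-sameSideEdges A C =
    trans (length-filterᵇ (λ k → mem (sameSideEdges A) (vtx C k) (vtx C (next5 k))) (allFin 5))
          (∑-cong (allFin 5) (λ {k} _ →
             cong (λ b → 𝟙 (b ∧ sameSide A (vtx C k , vtx C (next5 k)))) (adjacent C k)))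

proposition5p9 : (∀ (n : ℕ) (G : Graph n) (w : Weights n) →
    Connected G → TriangleFree G → MaxDegreeAtMost G 3 → NonNegative w →
    MacAtLeast G w (fourFifths * totalWeight G w)) →
    ∀ (n : ℕ) (G : Graph n) →
    Connected G → TriangleFree G → MaxDegreeAtMost G 3 →
    Σ (EdgeSet G) λ E′ → ∀ (C : FiveCycle G) → edgesOfCycleIn E′ C ≡ 1
proposition5p9 mac≥⅘w n G connected triangle-free Δ≤3 = sameSideEdges G A , meets-once
  where
  large-cut = mac≥⅘w n G (loadWeights G) connected triangle-free Δ≤3 (λ _ _ → fromℕ-nonNeg _)
  A = proj₁ large-cut

  monochromatic-once : ∀ {W} → W ∈ closedWalks₅ G → monochromatic A (steps₅ W) ≡ 1
  monochromatic-once = ∑-≤-pointwise⇒≡ (closedWalks₅ G) (1≤monochromatic-steps₅ A)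
                         (fourFifths-cut⇒monochromatic≤ G A (proj₂ large-cut))

  meets-once : ∀ C → edgesOfCycleIn (sameSideEdges G A) C ≡ 1
  meets-once C = trans (edgesOfCycleIn-sameSideEdges G A C) (monochromatic-once (walk₅-closed G C))
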